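{- Let $q\geq3$ and let $b_1,\dots,b_n$ be integers. Then $[b_1,\dots,b_n]_q$ is a geodesic Rosen continued fraction if and only if $[-b_1,\dots,-b_n]_q$ is a geodesic Rosen continued fraction.
   Context: Let $\lambda_q=2\cos(\pi/q)$. For integers $b_1,\dots,b_n$ with $s_i(z)=b_i\lambda_q-1/z$, the Rosen continued fraction $[b_1,\dots,b_n]_q$ has value $s_1\circ\dots\circ s_n(\infty)\in\mathbb{R}\cup\{\infty\}$; it is geodesic if every finite Rosen continued fraction (any length, integer entries) with the same value has at least $n$ terms. -}

module Defs where

open import Data.Nat as ℕ using (ℕ; zero; suc; _≟_; _∸_)
open import Data.Nat.Divisibility using (_∣?_)
open import Data.Integer as ℤ using (ℤ; +_; -[1+_])
open import Data.List using (List; []; _∷_; map; foldr; filter; upTo; replicate; _++_; length)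
open import Data.Product using (_×_; _,_)
open import Data.Bool using (if_then_else_)
open import Relation.Nullary.Decidable using (⌊_⌋)
open import Relation.Binary.PropositionalEquality using (_≡_)

-- Integer polynomials, as coefficient lists (constant term first).
-- We model the cyclotomic ring Z[ζ], ζ = exp(iπ/q), a primitive
-- m-th root of unity with m = 2q.  λ_q = 2cos(π/q) = ζ + ζ⁻¹ = ζ + ζ^(m-1).

Poly : Set
Poly = List ℤ

_⊕_ : Poly → Poly → Poly
[]      ⊕ g       = g
(a ∷ f) ⊕ []      = a ∷ f
(a ∷ f) ⊕ (b ∷ g) = (a ℤ.+ b) ∷ (f ⊕ g)

scale : ℤ → Poly → Poly
scale a = map (a ℤ.*_)

_⊗_ : Poly → Poly → Poly
[]      ⊗ g = []
(a ∷ f) ⊗ g = scale a g ⊕ (+ 0 ∷ (f ⊗ g))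

negP : Poly → Poly
negP = map (λ x → ℤ.- x)

oneP : Poly
oneP = + 1 ∷ []

X^ : ℕ → Poly
X^ d = replicate d (+ 0) ++ (+ 1 ∷ [])

ord : ℕ → ℕ
ord q = 2 ℕ.* q

lam : ℕ → Poly
lam q = X^ 1 ⊕ X^ (ord q ∸ 1)

-- Q_m = ∏_{1 ≤ d < m, d ∣ m} (x^d - 1): vanishes exactly at the
-- non-primitive m-th roots of unity.
Qm : ℕ → Poly
Qm m = foldr (λ d acc → (X^ d ⊕ negP oneP) ⊗ acc) oneP
             (filter (λ d → d ∣? m) (map suc (upTo (m ∸ 1))))

nextRes : ℕ → ℕ → ℕ
nextRes m j = if ⌊ suc j ≟ m ⌋ then 0 else suc j

coeffSum : ℕ → ℕ → ℕ → Poly → ℤ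
coeffSum m r j []      = + 0
coeffSum m r j (a ∷ f) =
  (if ⌊ j ≟ r ⌋ then a else + 0) ℤ.+ coeffSum m r (nextRes m j) f

-- f(ζ) = 0 for ζ a primitive (2q)-th root of unity.
-- Since x^m - 1 is squarefree and f has rational coefficients:
-- f(ζ) = 0  ⇔  f vanishes at all primitive m-th roots
--           ⇔  f·Q_m vanishes at all m-th roots
--           ⇔  f·Q_m ≡ 0 (mod x^m - 1).
VanishesAtζ : ℕ → Poly → Set
VanishesAtζ q f =
  ∀ r → r ℕ.< ord q → coeffSum (ord q) r 0 (f ⊗ Qm (ord q)) ≡ + 0

-- Rosen continued fractions.
-- s_b(z) = bλ - 1/z.  A point of R ∪ {∞} is a homogeneous pair (a , c)
-- standing for a/c; ∞ = (1 , 0).  s_b(a/c) = (bλa - c)/a.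

rcfValue : ℕ → List ℤ → Poly × Poly
rcfValue q []       = oneP , []
rcfValue q (b ∷ bs) with rcfValue q bs
... | a , c = (scale b (lam q) ⊗ a) ⊕ negP c , a

-- equality of values in R ∪ {∞}: a c' - a' c = 0 (both pairs are nonzero
-- since the matrices have determinant 1)
SameValue : ℕ → Poly × Poly → Poly × Poly → Set
SameValue q (a , c) (a' , c') = VanishesAtζ q ((a ⊗ c') ⊕ negP (a' ⊗ c))

Geodesic : ℕ → List ℤ → Set
Geodesic q bs =
  ∀ (cs : List ℤ) → SameValue q (rcfValue q cs) (rcfValue q bs) → length bs ℕ.≤ length cs

{-# OPTIONS --safe #-}
-- The reflection z ↦ -z conjugates s_b into s_{-b}: s_{-b}(-z) = -s_b(z).
-- Hence [-b_1,…,-b_n]_q = -[b_1,…,b_n]_q, and since z ↦ -z is a bijection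
-- of ℝ ∪ {∞} that preserves the length of expansions, it maps the shortest
-- expansions of a value to the shortest expansions of its negative.
module Submission where

open import Defs
open import Data.Nat using (ℕ; _≤_)
open import Data.Integer using (ℤ; -_)
open import Data.List using (List; map)
open import Function.Bundles using (_⇔_)

open import Data.Nat using (_≟_)
open import Data.Integer using (+_; +0; _+_; _*_)
open import Data.Integer.Properties
  using (neg-involutive; neg-distrib-+; neg-distribˡ-*; neg-distribʳ-*)
open import Data.List using ([]; _∷_)
open import Data.List.Properties using (map-id; map-∘; map-cong; length-map)
open import Data.Bool using (if_then_else_)
open import Data.Bool.Properties using (if-float)
open import Data.Product using (_×_; _,_)
open import Data.Sum using (_⊎_; inj₁; inj₂)
open import Function.Base using (_∘_)
open import Function.Bundles using (mk⇔)
open import Relation.Nullary.Decidable using (⌊_⌋)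
open import Relation.Binary.PropositionalEquality
open ≡-Reasoning

map-neg-involutive : (xs : List ℤ) → map -_ (map -_ xs) ≡ xs
map-neg-involutive xs = begin
  map -_ (map -_ xs)  ≡⟨ map-∘ xs ⟨
  map (-_ ∘ -_) xs    ≡⟨ map-cong neg-involutive xs ⟩
  map (λ x → x) xs    ≡⟨ map-id xs ⟩
  xs                  ∎

negP-⊕ : ∀ f g → negP (f ⊕ g) ≡ negP f ⊕ negP g
negP-⊕ []      g       = refl
negP-⊕ (a ∷ f) []      = refl
negP-⊕ (a ∷ f) (b ∷ g) = cong₂ _∷_ (neg-distrib-+ a b) (negP-⊕ f g)

scale-negˡ : ∀ a f → scale (- a) f ≡ negP (scale a f)
scale-negˡ a f = trans (map-cong (λ x → sym (neg-distribˡ-* a x)) f) (map-∘ f)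

scale-negʳ : ∀ a f → scale a (negP f) ≡ negP (scale a f)
scale-negʳ a f = begin
  scale a (negP f)     ≡⟨ map-∘ f ⟨
  map ((a *_) ∘ -_) f  ≡⟨ map-cong (λ x → sym (neg-distribʳ-* a x)) f ⟩
  map (-_ ∘ (a *_)) f  ≡⟨ map-∘ f ⟩
  negP (scale a f)     ∎

⊗-negˡ : ∀ f g → negP f ⊗ g ≡ negP (f ⊗ g)
⊗-negˡ []      g = refl
⊗-negˡ (a ∷ f) g = begin
  scale (- a) g ⊕ (+0 ∷ (negP f ⊗ g))      ≡⟨ cong₂ (λ x y → x ⊕ (+0 ∷ y)) (scale-negˡ a g) (⊗-negˡ f g) ⟩
  negP (scale a g) ⊕ negP (+0 ∷ (f ⊗ g))   ≡⟨ negP-⊕ (scale a g) (+0 ∷ (f ⊗ g)) ⟨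
  negP (scale a g ⊕ (+0 ∷ (f ⊗ g)))        ∎

⊗-negʳ : ∀ f g → f ⊗ negP g ≡ negP (f ⊗ g)
⊗-negʳ []      g = refl
⊗-negʳ (a ∷ f) g = begin
  scale a (negP g) ⊕ (+0 ∷ (f ⊗ negP g))   ≡⟨ cong₂ (λ x y → x ⊕ (+0 ∷ y)) (scale-negʳ a g) (⊗-negʳ f g) ⟩
  negP (scale a g) ⊕ negP (+0 ∷ (f ⊗ g))   ≡⟨ negP-⊕ (scale a g) (+0 ∷ (f ⊗ g)) ⟨
  negP (scale a g ⊕ (+0 ∷ (f ⊗ g)))        ∎

⊗-neg-neg : ∀ f g → negP f ⊗ negP g ≡ f ⊗ g
⊗-neg-neg f g = begin
  negP f ⊗ negP g      ≡⟨ ⊗-negˡ f (negP g) ⟩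
  negP (f ⊗ negP g)    ≡⟨ cong negP (⊗-negʳ f g) ⟩
  negP (negP (f ⊗ g))  ≡⟨ map-neg-involutive (f ⊗ g) ⟩
  f ⊗ g                ∎

coeffSum-negP : ∀ m r j f → coeffSum m r j (negP f) ≡ - coeffSum m r j f
coeffSum-negP m r j []      = refl
coeffSum-negP m r j (a ∷ f) = begin
  (if j≟r then - a else + 0) + coeffSum m r (nextRes m j) (negP f)
    ≡⟨ cong₂ _+_ (sym (if-float -_ j≟r)) (coeffSum-negP m r (nextRes m j) f) ⟩
  - (if j≟r then a else + 0) + - coeffSum m r (nextRes m j) f
    ≡⟨ neg-distrib-+ (if j≟r then a else + 0) (coeffSum m r (nextRes m j) f) ⟨
  - ((if j≟r then a else + 0) + coeffSum m r (nextRes m j) f)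
    ∎
  where j≟r = ⌊ j ≟ r ⌋

VanishesAtζ-negP : ∀ q f → VanishesAtζ q f → VanishesAtζ q (negP f)
VanishesAtζ-negP q f f≈0 r r<m = begin
  coeffSum (ord q) r 0 (negP f ⊗ Qm (ord q))     ≡⟨ cong (coeffSum (ord q) r 0) (⊗-negˡ f (Qm (ord q))) ⟩
  coeffSum (ord q) r 0 (negP (f ⊗ Qm (ord q)))   ≡⟨ coeffSum-negP (ord q) r 0 (f ⊗ Qm (ord q)) ⟩
  - coeffSum (ord q) r 0 (f ⊗ Qm (ord q))        ≡⟨ cong -_ (f≈0 r r<m) ⟩
  + 0                                            ∎

-- Negation v w: the pair w represents −v.  A homogeneous pair is only determined up to sign, and
-- which coordinate carries the sign alternates with the length of the expansion.
data Negation : Poly × Poly → Poly × Poly → Set where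
  negate-numerator   : ∀ {a c} → Negation (a , c) (negP a , c)
  negate-denominator : ∀ {a c} → Negation (a , c) (a , negP c)

rcfValue-map-neg : ∀ q bs → Negation (rcfValue q bs) (rcfValue q (map -_ bs))
rcfValue-map-neg q []       = negate-denominator
rcfValue-map-neg q (b ∷ bs) with rcfValue q bs | rcfValue q (map -_ bs) | rcfValue-map-neg q bs
... | a , c | .(negP a , c) | negate-numerator =
  subst (λ x → Negation ((bλ ⊗ a) ⊕ negP c , a) ((x ⊕ negP c) , negP a))
        (sym (trans (cong (_⊗ negP a) (scale-negˡ b (lam q))) (⊗-neg-neg bλ a)))
        negate-denominator
  where bλ = scale b (lam q)
... | a , c | .(a , negP c) | negate-denominator =
  subst (Negation ((bλ ⊗ a) ⊕ negP c , a) ∘ (_, a)) (sym negated) negate-numerator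
  where
  bλ = scale b (lam q)
  negated : (scale (- b) (lam q) ⊗ a) ⊕ negP (negP c) ≡ negP ((bλ ⊗ a) ⊕ negP c)
  negated = begin
    (scale (- b) (lam q) ⊗ a) ⊕ negP (negP c)  ≡⟨ cong (λ x → (x ⊗ a) ⊕ negP (negP c)) (scale-negˡ b (lam q)) ⟩
    (negP bλ ⊗ a) ⊕ negP (negP c)              ≡⟨ cong (_⊕ negP (negP c)) (⊗-negˡ bλ a) ⟩
    negP (bλ ⊗ a) ⊕ negP (negP c)              ≡⟨ negP-⊕ (bλ ⊗ a) (negP c) ⟨
    negP ((bλ ⊗ a) ⊕ negP c)                   ∎

cross : Poly × Poly → Poly × Poly → Poly
cross (a , c) (a' , c') = (a ⊗ c') ⊕ negP (a' ⊗ c)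

cross-Negation : ∀ {v v' w w'} → Negation v v' → Negation w w' →
                 cross v' w' ≡ cross v w ⊎ cross v' w' ≡ negP (cross v w)
cross-Negation {a , c} {w = a' , c'} negate-numerator negate-numerator = inj₂ (begin
  (negP a ⊗ c') ⊕ negP (negP a' ⊗ c)    ≡⟨ cong₂ (λ x y → x ⊕ negP y) (⊗-negˡ a c') (⊗-negˡ a' c) ⟩
  negP (a ⊗ c') ⊕ negP (negP (a' ⊗ c))  ≡⟨ negP-⊕ (a ⊗ c') (negP (a' ⊗ c)) ⟨
  negP ((a ⊗ c') ⊕ negP (a' ⊗ c))       ∎)
cross-Negation {a , c} {w = a' , c'} negate-numerator negate-denominator =
  inj₁ (cong (_⊕ negP (a' ⊗ c)) (⊗-neg-neg a c'))
cross-Negation {a , c} {w = a' , c'} negate-denominator negate-numerator =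
  inj₁ (cong (λ y → (a ⊗ c') ⊕ negP y) (⊗-neg-neg a' c))
cross-Negation {a , c} {w = a' , c'} negate-denominator negate-denominator = inj₂ (begin
  (a ⊗ negP c') ⊕ negP (a' ⊗ negP c)    ≡⟨ cong₂ (λ x y → x ⊕ negP y) (⊗-negʳ a c') (⊗-negʳ a' c) ⟩
  negP (a ⊗ c') ⊕ negP (negP (a' ⊗ c))  ≡⟨ negP-⊕ (a ⊗ c') (negP (a' ⊗ c)) ⟨
  negP ((a ⊗ c') ⊕ negP (a' ⊗ c))       ∎)

SameValue-Negation : ∀ q {v v' w w'} → Negation v v' → Negation w w' →
                     SameValue q v w → SameValue q v' w'
SameValue-Negation q {v} {w = w} v⁻ w⁻ same with cross-Negation v⁻ w⁻
... | inj₁ unchanged = subst (VanishesAtζ q) (sym unchanged) same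
... | inj₂ negated   = subst (VanishesAtζ q) (sym negated) (VanishesAtζ-negP q (cross v w) same)

Geodesic-map-neg : ∀ q bs → Geodesic q bs → Geodesic q (map -_ bs)
Geodesic-map-neg q bs geodesic cs same =
  subst₂ _≤_ (sym (length-map -_ bs)) (length-map -_ cs) (geodesic (map -_ cs) same⁻)
  where
  same⁻ : SameValue q (rcfValue q (map -_ cs)) (rcfValue q bs)
  same⁻ = subst (SameValue q (rcfValue q (map -_ cs)) ∘ rcfValue q) (map-neg-involutive bs)
                (SameValue-Negation q (rcfValue-map-neg q cs) (rcfValue-map-neg q (map -_ bs)) same)

-- The symmetry holds for every q.
lemma18 : (q : ℕ) → 3 ≤ q → (bs : List ℤ) → Geodesic q bs ⇔ Geodesic q (map (λ b → - b) bs)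
lemma18 q _ bs = mk⇔ (Geodesic-map-neg q bs) backward
  where
  backward : Geodesic q (map -_ bs) → Geodesic q bs
  backward = subst (Geodesic q) (map-neg-involutive bs) ∘ Geodesic-map-neg q (map -_ bs)
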